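{- Let $G$ be a finite simple graph and let $G'$ be obtained from $G$ by removing $k$ edges of $G$. Then $\gamma_{gr}^L(G) - k \leq \gamma_{gr}^L(G') \leq \gamma_{gr}^L(G) + 2k$.
   Context: For a vertex $v$, $N(v)$ is its open neighborhood (the set of its neighbors) and $N[v] = N(v) \cup \{v\}$ its closed neighborhood. An L-sequence of a graph $G$ is a sequence $(v_1, \ldots, v_k)$ of distinct vertices of $G$ such that for every $i \in \{1,\ldots,k\}$, $N[v_i] \setminus \bigcup_{j=1}^{i-1} N(v_j) \neq \emptyset$. The L-Grundy domination number $\gamma_{gr}^L(G)$ is the maximum length of an L-sequence of $G$. -}

module Defs where

open import Data.Nat using (ℕ; _<_)
open import Data.Fin using (Fin; toℕ)
open import Data.Bool using (Bool; true; false)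
open import Data.List using (List; []; _∷_; length; _++_)
open import Data.List.Membership.Propositional using (_∈_)
open import Data.List.Relation.Unary.All using (All)
open import Data.List.Relation.Unary.Unique.Propositional using (Unique)
open import Data.Product using (Σ; _×_; _,_; ∃)
open import Data.Sum using (_⊎_)
open import Relation.Nullary using (¬_)
open import Relation.Binary.PropositionalEquality using (_≡_)

record Graph (n : ℕ) : Set where
  field
    adj   : Fin n → Fin n → Bool
    sym   : ∀ u v → adj u v ≡ adj v u
    irrfl : ∀ v → adj v v ≡ false
open Graph public

_∈N⟨_⟩_ : {n : ℕ} → Fin n → Graph n → Fin n → Set
u ∈N⟨ G ⟩ v = adj G v u ≡ true

_∈N[_]_ : {n : ℕ} → Fin n → Graph n → Fin n → Set
u ∈N[ G ] v = (u ≡ v) ⊎ (u ∈N⟨ G ⟩ v)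

NewFootprint : {n : ℕ} → Graph n → List (Fin n) → Fin n → Set
NewFootprint G prev v = ∃ λ u → (u ∈N[ G ] v) × All (λ w → ¬ (u ∈N⟨ G ⟩ w)) prev

LCond : {n : ℕ} → Graph n → List (Fin n) → List (Fin n) → Set
LCond G prev []       = Data.Unit.⊤ where import Data.Unit
LCond G prev (v ∷ vs) = NewFootprint G prev v × LCond G (prev ++ (v ∷ [])) vs

IsLSequence : {n : ℕ} → Graph n → List (Fin n) → Set
IsLSequence G s = Unique s × LCond G [] s

IsLGrundyNumber : {n : ℕ} → Graph n → ℕ → Set
IsLGrundyNumber G m =
  (∃ λ s → IsLSequence G s × length s ≡ m) ×
  (∀ s → IsLSequence G s → length s Data.Nat.≤ m)
  where import Data.Nat

-- An edge {u,v} of G, represented canonically with toℕ u < toℕ v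
Edge : {n : ℕ} → Graph n → Set
Edge {n} G = Σ (Fin n) λ u → Σ (Fin n) λ v → (toℕ u < toℕ v) × (adj G u v ≡ true)

SamePair : {n : ℕ} {G : Graph n} → Fin n → Fin n → Edge G → Set
SamePair a b (u , v , _) = ((a ≡ u) × (b ≡ v)) ⊎ ((a ≡ v) × (b ≡ u))

RemovesEdges : {n : ℕ} (G G' : Graph n) → List (Edge G) → Set
RemovesEdges {n} G G' es =
  ∀ (a b : Fin n) →
    (adj G' a b ≡ true) ⇔ ((adj G a b ≡ true) × ¬ (Data.List.Relation.Unary.Any.Any (SamePair {G = G} a b) es))
  where
    import Data.List.Relation.Unary.Any
    open import Function.Bundles using (_⇔_)

{-# OPTIONS --safe #-}

-- For γ(G) ≤ γ(G') + k, scan an L-sequence of G and keep each vertex that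
-- still has a new footprint in G' with respect to the vertices kept so far.
-- Call a removed edge exposed if one of its endpoints is not yet dominated in
-- G.  A discarded vertex v has a G-footprint u with uv removed; v is already
-- dominated (it is not its own footprint in G'), and appending v dominates u,
-- so uv stops being exposed.  Hence at most k vertices are discarded.
-- For γ(G') ≤ γ(G) + 2k, an L-sequence of G' stays an L-sequence of G after
-- deleting the endpoints of removed edges, since every other vertex has the
-- same neighbourhood in G and G'; having no repetitions, it loses at most 2k.

module Submission where

open import Defs hiding (sym)
open import Data.Nat using (ℕ; suc; _≤_; _<_; _+_; _*_; z≤n; s≤s)
open import Data.Nat.Properties
  using ( ≤-trans; ≤-reflexive; m≤n⇒m≤1+n; +-suc; *-suc; +-monoˡ-≤; +-monoʳ-≤
        ; module ≤-Reasoning)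
open import Data.Bool using (true)
import Data.Bool.Properties as Bool
open import Data.Fin using (Fin)
import Data.Fin.Properties as Fin
open import Data.List using (List; []; _∷_; _++_; _∷ʳ_; length; filter)
open import Data.List.Properties using (length-++; length-filter; filter-notAll)
open import Data.List.Membership.Propositional using (_∈_; _∉_)
open import Data.List.Membership.Propositional.Properties
  using (∈-++⁺ˡ; ∈-++⁺ʳ; ∈-filter⁺)
open import Data.List.Relation.Binary.Subset.Propositional using (_⊆_)
open import Data.List.Relation.Binary.Subset.Propositional.Properties
  using (⊆-trans; xs⊆xs++ys; ++⁺ˡ; All-resp-⊇)
import Data.List.Relation.Binary.Sublist.Propositional as Sublist
import Data.List.Relation.Binary.Sublist.Propositional.Properties as Sublist
open import Data.List.Relation.Unary.All as All using (All; []; _∷_)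
open import Data.List.Relation.Unary.All.Properties using (++⁻ˡ; ∷ʳ⁺; ∷ʳ⁻)
open import Data.List.Relation.Unary.AllPairs using (AllPairs; []; _∷_)
open import Data.List.Relation.Unary.Any as Any using (Any; here; there)
open import Data.List.Relation.Unary.Unique.Propositional using (Unique)
open import Data.List.Relation.Unary.Unique.Propositional.Properties using (filter⁺)
open import Data.Product using (_×_; _,_; proj₁; proj₂; ∃)
open import Data.Sum as Sum using (_⊎_; inj₁; inj₂; [_,_])
open import Function using (_∘_)
open import Function.Bundles using (Equivalence)
open import Relation.Binary.Core using (Rel)
open import Relation.Binary.Definitions using (DecidableEquality)
open import Relation.Binary.PropositionalEquality using (_≡_; refl; cong; trans; sym)
open import Relation.Nullary using (¬_; yes; no; ¬?; contradiction)
open import Relation.Nullary.Decidable using (_×-dec_; _⊎-dec_; decidable-stable)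
open import Relation.Unary using (Pred; Decidable)

module _ {a r} {A : Set a} {R : Rel A r} where

  AllPairs-resp-⊆ : ∀ {xs ys : List A} → xs Sublist.⊆ ys → AllPairs R ys → AllPairs R xs
  AllPairs-resp-⊆ Sublist.[]         []            = []
  AllPairs-resp-⊆ (_ Sublist.∷ʳ xs⊑ys) (_ ∷ ys!)   = AllPairs-resp-⊆ xs⊑ys ys!
  AllPairs-resp-⊆ (refl Sublist.∷ xs⊑ys) (y ∷ ys!) =
    Sublist.All-resp-⊆ xs⊑ys y ∷ AllPairs-resp-⊆ xs⊑ys ys!

module _ {a p q} {A : Set a} {P : Pred A p} {Q : Pred A q}
         (P? : Decidable P) (Q? : Decidable Q) (Q⇒P : ∀ {x} → Q x → P x) where

  length-filter-mono : ∀ xs → length (filter Q? xs) ≤ length (filter P? xs)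
  length-filter-mono []       = z≤n
  length-filter-mono (x ∷ xs) with P? x | Q? x
  ... | yes _  | yes _  = s≤s (length-filter-mono xs)
  ... | yes _  | no _   = m≤n⇒m≤1+n (length-filter-mono xs)
  ... | no ¬px | yes qx = contradiction (Q⇒P qx) ¬px
  ... | no _   | no _   = length-filter-mono xs

  length-filter-< : ∀ xs → Any (λ x → P x × ¬ Q x) xs →
                    length (filter Q? xs) < length (filter P? xs)
  length-filter-< (x ∷ xs) (here (px , ¬qx)) with P? x | Q? x
  ... | no ¬px | _      = contradiction px ¬px
  ... | yes _  | yes qx = contradiction qx ¬qx
  ... | yes _  | no _   = s≤s (length-filter-mono xs)
  length-filter-< (x ∷ xs) (there any) with P? x | Q? x
  ... | yes _  | yes _  = s≤s (length-filter-< xs any)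
  ... | yes _  | no _   = m≤n⇒m≤1+n (length-filter-< xs any)
  ... | no ¬px | yes qx = contradiction (Q⇒P qx) ¬px
  ... | no _   | no _   = length-filter-< xs any

module _ {a} {A : Set a} (_≟_ : DecidableEquality A) where

  Unique-⊆⇒length≤ : ∀ {xs ys : List A} → Unique xs → xs ⊆ ys → length xs ≤ length ys
  Unique-⊆⇒length≤ {[]}     _            _     = z≤n
  Unique-⊆⇒length≤ {x ∷ xs} {ys} (x∉xs ∷ xs!) xs⊆ys = begin-strict
    length xs              ≤⟨ Unique-⊆⇒length≤ xs! xs⊆ys-x ⟩
    length (filter ≢x? ys) <⟨ filter-notAll ≢x? ys (Any.map (λ x≡y x≢y → x≢y x≡y) x∈ys) ⟩
    length ys              ∎
    where
    open ≤-Reasoning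
    x∈ys : x ∈ ys
    x∈ys = xs⊆ys (here refl)
    ≢x? : Decidable (λ y → ¬ x ≡ y)
    ≢x? y = ¬? (x ≟ y)
    xs⊆ys-x : xs ⊆ filter ≢x? ys
    xs⊆ys-x y∈xs = ∈-filter⁺ ≢x? (xs⊆ys (there y∈xs)) (All.lookup x∉xs y∈xs)

module _ {n : ℕ} where

  open import Data.List.Membership.DecPropositional (Fin._≟_ {n}) using (_∈?_; _∉?_)

  infix 4 _⊆ᴳ_
  record _⊆ᴳ_ (H G : Graph n) : Set where
    field adj⊆ : ∀ a b → adj H a b ≡ true → adj G a b ≡ true
  open _⊆ᴳ_

  Undominated : Graph n → List (Fin n) → Fin n → Set
  Undominated G q u = All (λ w → ¬ u ∈N⟨ G ⟩ w) q

  undominated? : ∀ G q → Decidable (Undominated G q)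
  undominated? G q u = All.all? (λ w → ¬? (adj G w u Bool.≟ true)) q

  newFootprint? : ∀ G p → Decidable (NewFootprint G p)
  newFootprint? G p v =
    Fin.any? λ u → ((u Fin.≟ v) ⊎-dec (adj G v u Bool.≟ true)) ×-dec undominated? G p u

  Undominated-⊆ : ∀ {H G p q u} → H ⊆ᴳ G → p ⊆ q → Undominated G q u → Undominated H p u
  Undominated-⊆ {u = u} H⊆G p⊆q =
    All.map (λ {w} ¬adjG adjH → ¬adjG (adj⊆ H⊆G w u adjH)) ∘ All-resp-⊇ p⊆q

  IsLGrundyNumber-≤ : ∀ (G H : Graph n) {m m' c} →
                      IsLGrundyNumber G m → IsLGrundyNumber H m' →
                      (∀ {s} → IsLSequence G s →
                               ∃ λ t → IsLSequence H t × length s ≤ length t + c) →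
                      m ≤ m' + c
  IsLGrundyNumber-≤ G H ((s , s-L , refl) , _) (_ , maxH) shorten with shorten s-L
  ... | t , t-L , s≤t+c = ≤-trans s≤t+c (+-monoˡ-≤ _ (maxH t t-L))

  prune : Graph n → List (Fin n) → List (Fin n) → List (Fin n)
  prune H p []       = []
  prune H p (v ∷ vs) with newFootprint? H p v
  ... | yes _ = v ∷ prune H (p ∷ʳ v) vs
  ... | no _  = prune H p vs

  prune-LCond : ∀ H p vs → LCond H p (prune H p vs)
  prune-LCond H p []       = _
  prune-LCond H p (v ∷ vs) with newFootprint? H p v
  ... | yes fp = fp , prune-LCond H (p ∷ʳ v) vs
  ... | no _   = prune-LCond H p vs

  prune-Sublist : ∀ H p vs → prune H p vs Sublist.⊆ vs
  prune-Sublist H p []       = Sublist.[]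
  prune-Sublist H p (v ∷ vs) with newFootprint? H p v
  ... | yes _ = refl Sublist.∷ prune-Sublist H (p ∷ʳ v) vs
  ... | no _  = v Sublist.∷ʳ prune-Sublist H p vs

  module _ {G G' : Graph n} (G'⊆G : G' ⊆ᴳ G) (es : List (Edge G))
           (removed∈es : ∀ a b → adj G a b ≡ true → ¬ adj G' a b ≡ true →
                         Any (SamePair {G = G} a b) es) where

    Exposed : List (Fin n) → Edge G → Set
    Exposed q (x , y , _) = Undominated G q x ⊎ Undominated G q y

    exposed? : ∀ q → Decidable (Exposed q)
    exposed? q (x , y , _) = undominated? G q x ⊎-dec undominated? G q y

    exposed : List (Fin n) → List (Edge G)
    exposed q = filter (exposed? q) es

    Exposed-∷ʳ⁻ : ∀ q v e → Exposed (q ∷ʳ v) e → Exposed q e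
    Exposed-∷ʳ⁻ q v (_ , _ , _) = Sum.map (++⁻ˡ q) (++⁻ˡ q)

    dropped⇒unexposes : ∀ {p q v} → p ⊆ q → NewFootprint G q v → ¬ NewFootprint G' p v →
                        Any (λ e → Exposed q e × ¬ Exposed (q ∷ʳ v) e) es
    dropped⇒unexposes {q = q} {v} p⊆q (u , u∈N[v] , u-und) ¬fp' with u∈N[v]
    ... | inj₁ u≡v  = contradiction (u , inj₁ u≡v , Undominated-⊆ G'⊆G p⊆q u-und) ¬fp'
    ... | inj₂ vu∈G with adj G' v u Bool.≟ true
    ...   | yes vu∈G' = contradiction (u , inj₂ vu∈G' , Undominated-⊆ G'⊆G p⊆q u-und) ¬fp'
    ...   | no vu∉G'  = Any.map (λ {e} → unexposed e) (removed∈es v u vu∈G vu∉G')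
      where
      v-dominated : ¬ Undominated G (q ∷ʳ v) v
      v-dominated v-und = ¬fp' (v , inj₁ refl , Undominated-⊆ G'⊆G p⊆q (++⁻ˡ q v-und))
      u-dominated : ¬ Undominated G (q ∷ʳ v) u
      u-dominated u-und′ = proj₂ (∷ʳ⁻ u-und′) vu∈G
      unexposed : ∀ e → SamePair {G = G} v u e → Exposed q e × ¬ Exposed (q ∷ʳ v) e
      unexposed (_ , _ , _) (inj₁ (refl , refl)) = inj₂ u-und , [ v-dominated , u-dominated ]
      unexposed (_ , _ , _) (inj₂ (refl , refl)) = inj₁ u-und , [ u-dominated , v-dominated ]

    length-exposed-∷ʳ : ∀ q v → length (exposed (q ∷ʳ v)) ≤ length (exposed q)
    length-exposed-∷ʳ q v =
      length-filter-mono (exposed? q) (exposed? (q ∷ʳ v)) (λ {e} → Exposed-∷ʳ⁻ q v e) es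

    length-exposed-∷ʳ-< : ∀ {p q v} → p ⊆ q → NewFootprint G q v → ¬ NewFootprint G' p v →
                          length (exposed (q ∷ʳ v)) < length (exposed q)
    length-exposed-∷ʳ-< {q = q} {v} p⊆q fp ¬fp' =
      length-filter-< (exposed? q) (exposed? (q ∷ʳ v)) (λ {e} → Exposed-∷ʳ⁻ q v e) es
                      (dropped⇒unexposes p⊆q fp ¬fp')

    length-≤-prune+exposed : ∀ {p q} vs → p ⊆ q → LCond G q vs →
                             length vs ≤ length (prune G' p vs) + length (exposed q)
    length-≤-prune+exposed []       _   _        = z≤n
    length-≤-prune+exposed {p} {q} (v ∷ vs) p⊆q (fp , lc) with newFootprint? G' p v
    ... | yes _ = s≤s (begin
      length vs
        ≤⟨ length-≤-prune+exposed vs (++⁺ˡ (v ∷ []) p⊆q) lc ⟩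
      length (prune G' (p ∷ʳ v) vs) + length (exposed (q ∷ʳ v))
        ≤⟨ +-monoʳ-≤ _ (length-exposed-∷ʳ q v) ⟩
      length (prune G' (p ∷ʳ v) vs) + length (exposed q) ∎)
      where open ≤-Reasoning
    ... | no ¬fp' = begin
      suc (length vs)
        ≤⟨ s≤s (length-≤-prune+exposed vs (⊆-trans p⊆q (xs⊆xs++ys q (v ∷ []))) lc) ⟩
      suc (length (prune G' p vs) + length (exposed (q ∷ʳ v)))
        ≡⟨ +-suc _ _ ⟨
      length (prune G' p vs) + suc (length (exposed (q ∷ʳ v)))
        ≤⟨ +-monoʳ-≤ _ (length-exposed-∷ʳ-< p⊆q fp ¬fp') ⟩
      length (prune G' p vs) + length (exposed q) ∎
      where open ≤-Reasoning

    IsLSequence-prune : ∀ {s} → IsLSequence G s →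
                        ∃ λ s' → IsLSequence G' s' × length s ≤ length s' + length es
    IsLSequence-prune {s} (s! , lc) =
      prune G' [] s ,
      (AllPairs-resp-⊆ (prune-Sublist G' [] s) s! , prune-LCond G' [] s) ,
      ≤-trans (length-≤-prune+exposed s (λ ()) lc)
              (+-monoʳ-≤ _ (length-filter (exposed? []) es))

  module _ {G G' : Graph n} (G'⊆G : G' ⊆ᴳ G) (B : List (Fin n))
           (kept : ∀ w u → w ∉ B → adj G w u ≡ true → adj G' w u ≡ true) where

    LCond-restrict : ∀ {p q} vs → p ⊆ q → All (_∉ B) p → LCond G' q vs →
                     LCond G p (filter (_∉? B) vs)
    LCond-restrict []       _ _ _ = _
    LCond-restrict {p} {q} (v ∷ vs) p⊆q p∉B ((u , u∈N[v] , u-und) , lc) with v ∈? B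
    ... | no v∉B  = (u , Sum.map₂ (adj⊆ G'⊆G v u) u∈N[v] , u-undG)
                  , LCond-restrict vs (++⁺ˡ (v ∷ []) p⊆q) (∷ʳ⁺ p∉B v∉B) lc
      where
      u-undG : Undominated G p u
      u-undG = All.zipWith (λ (¬wu∈G' , w∉B) wu∈G → ¬wu∈G' (kept _ u w∉B wu∈G))
                           (All-resp-⊇ p⊆q u-und , p∉B)
    ... | yes _   = LCond-restrict vs (⊆-trans p⊆q (xs⊆xs++ys q (v ∷ []))) p∉B lc

    IsLSequence-restrict : ∀ {s} → IsLSequence G' s →
                           ∃ λ s' → IsLSequence G s' × length s ≤ length s' + length B
    IsLSequence-restrict {s} (s! , lc) =
      filter (_∉? B) s ,
      (filter⁺ (_∉? B) s! , LCond-restrict s (λ ()) [] lc) ,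
      (begin
        length s                           ≤⟨ Unique-⊆⇒length≤ Fin._≟_ s! s⊆kept++B ⟩
        length (filter (_∉? B) s ++ B)     ≡⟨ length-++ (filter (_∉? B) s) ⟩
        length (filter (_∉? B) s) + length B ∎)
      where
      open ≤-Reasoning
      s⊆kept++B : s ⊆ filter (_∉? B) s ++ B
      s⊆kept++B {x} x∈s with x ∈? B
      ... | yes x∈B = ∈-++⁺ʳ _ x∈B
      ... | no x∉B  = ∈-++⁺ˡ (∈-filter⁺ (_∉? B) x∈s x∉B)

  module Removal (G G' : Graph n) (es : List (Edge G)) (removes : RemovesEdges G G' es) where

    open Equivalence

    G'⊆G : G' ⊆ᴳ G
    G'⊆G = record { adj⊆ = λ a b → proj₁ ∘ to (removes a b) }

    removed∈es : ∀ a b → adj G a b ≡ true → ¬ adj G' a b ≡ true → Any (SamePair {G = G} a b) es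
    removed∈es a b ab∈G ab∉G' =
      decidable-stable (Any.any? samePair? es)
                       (λ ab∉es → ab∉G' (from (removes a b) (ab∈G , ab∉es)))
      where
      samePair? : Decidable (SamePair {G = G} a b)
      samePair? (x , y , _) =
        ((a Fin.≟ x) ×-dec (b Fin.≟ y)) ⊎-dec ((a Fin.≟ y) ×-dec (b Fin.≟ x))

    endpoints : List (Edge G) → List (Fin n)
    endpoints []                  = []
    endpoints ((x , y , _) ∷ ds) = x ∷ y ∷ endpoints ds

    length-endpoints : ∀ ds → length (endpoints ds) ≡ 2 * length ds
    length-endpoints []                  = refl
    length-endpoints ((_ , _ , _) ∷ ds) =
      trans (cong (2 +_) (length-endpoints ds)) (sym (*-suc 2 (length ds)))

    SamePair⇒∈endpoints : ∀ {a b} ds → Any (SamePair {G = G} a b) ds → a ∈ endpoints ds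
    SamePair⇒∈endpoints (_ ∷ _)  (here (inj₁ (refl , _))) = here refl
    SamePair⇒∈endpoints (_ ∷ _)  (here (inj₂ (refl , _))) = there (here refl)
    SamePair⇒∈endpoints (_ ∷ ds) (there a∈ds) = there (there (SamePair⇒∈endpoints ds a∈ds))

    kept-off-endpoints : ∀ w u → w ∉ endpoints es → adj G w u ≡ true → adj G' w u ≡ true
    kept-off-endpoints w u w∉B wu∈G = from (removes w u) (wu∈G , w∉B ∘ SamePair⇒∈endpoints es)

corollary4p2 : ∀ {n : ℕ} (G G' : Graph n) (k : ℕ) (es : List (Edge G)) →
    Unique es → length es ≡ k → RemovesEdges G G' es →
    ∀ (m m' : ℕ) → IsLGrundyNumber G m → IsLGrundyNumber G' m' →
    (m ≤ m' + k) × (m' ≤ m + 2 * k)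
-- The bounds hold with k = length es even if es has repetitions.
corollary4p2 G G' k es _ refl removes m m' γ γ' =
  IsLGrundyNumber-≤ G G' γ γ' (IsLSequence-prune G'⊆G es removed∈es) ,
  ≤-trans (IsLGrundyNumber-≤ G' G γ' γ
             (IsLSequence-restrict G'⊆G (endpoints es) kept-off-endpoints))
          (+-monoʳ-≤ m (≤-reflexive (length-endpoints es)))
  where open Removal G G' es removes
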